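{- Let $G$ be a finite simple graph, and let $\kappa: V(G)\to \mathbb{N}\cup\{0\}$ and $\tau: V(G)\to \mathbb{Z}$ be functions such that $\tau(v)+\kappa(v)=\deg_G(v)$ for every vertex $v$ of $G$. Then a subset $M\subseteq V(G)$ is a $\tau$-dynamic monopoly of $G$ if and only if the induced subgraph $G\setminus M$ is $\kappa$-degenerate (with respect to the restriction of $\kappa$ to $V(G)\setminus M$).
   Context: For a graph $H$ and a function $\kappa: V(H)\to\mathbb{N}\cup\{0\}$, $H$ is called $\kappa$-degenerate if its vertices can be ordered $v_1,\dots,v_h$ so that for every $i$, the degree of $v_i$ in the subgraph of $H$ induced by $\{v_1,\dots,v_i\}$ is at most $\kappa(v_i)$ (the graph with no vertices is $\kappa$-degenerate). A threshold assignment for $G$ is a function $\tau:V(G)\to\mathbb{Z}$ with $\tau(v)\le \deg_G(v)$ for all $v$ (thresholds may be non-positive). A subset $D\subseteq V(G)$ is a $\tau$-dynamic monopoly if there is a partition of $V(G)$ into sets $D_0,D_1,\dots,D_k$ with $D_0=D$ such that for each $i=0,\dots,k-1$, every vertex $v\in D_{i+1}$ has at least $\tau(v)$ neighbors in $D_0\cup\dots\cup D_i$ (equivalently: starting with the vertices of $D$ active and repeatedly activating every vertex $v$ having at least $\tau(v)$ active neighbors, all vertices eventually become active). -}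

module Defs where

open import Data.Nat using (ℕ; zero; suc; _+_; _≤_; _≤ᵇ_)
open import Data.Integer using (ℤ; +_; _≤_)
open import Data.Bool using (Bool; true; false; if_then_else_; _∧_; T)
open import Data.Fin using (Fin; zero; suc; toℕ)
open import Data.Fin.Subset using (Subset; _∈_; _∉_)
open import Data.List using (List; length; lookup; take; filter)
open import Data.List.Membership.Propositional using () renaming (_∈_ to _∈ₗ_)
open import Data.List.Relation.Unary.Unique.Propositional using (Unique)
open import Data.Product using (Σ; _×_)
open import Function.Bundles using (_⇔_)
open import Relation.Binary.PropositionalEquality using (_≡_)

record Graph (n : ℕ) : Set where
  field
    adj    : Fin n → Fin n → Bool
    sym    : ∀ u v → adj u v ≡ adj v u
    irrefl : ∀ v → adj v v ≡ false
open Graph public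

countFin : ∀ {n} → (Fin n → Bool) → ℕ
countFin {zero}  p = 0
countFin {suc n} p = (if p zero then 1 else 0) + countFin (λ i → p (suc i))

countList : ∀ {A : Set} → (A → Bool) → List A → ℕ
countList p Data.List.[] = 0
countList p (x Data.List.∷ xs) = (if p x then 1 else 0) + countList p xs

deg : ∀ {n} → Graph n → Fin n → ℕ
deg G v = countFin (adj G v)

-- A partition D_0, D_1, ..., D_k of V(G) is encoded by a stage function
-- st : V(G) → ℕ (D_i = st⁻¹(i); k = any bound on st).
IsDynamicMonopoly : ∀ {n} → Graph n → (Fin n → ℤ) → Subset n → Set
IsDynamicMonopoly {n} G τ D =
  Σ (Fin n → ℕ) λ st →
    (∀ v → (v ∈ D) ⇔ (st v ≡ 0)) ×
    (∀ v i → st v ≡ suc i →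
       τ v Data.Integer.≤ + countFin (λ u → adj G v u ∧ (st u ≤ᵇ i)))

-- An ordering v_1, ..., v_h of V(G) \ M is a duplicate-free list whose
-- elements are exactly the vertices not in M; for every position i the degree
-- of v_i in the subgraph induced by {v_1, ..., v_i} is at most κ(v_i).
degIn : ∀ {n} → Graph n → List (Fin n) → Fin n → ℕ
degIn G S v = countList (adj G v) S

IsDegenerateOrdering : ∀ {n} → Graph n → (Fin n → ℕ) → List (Fin n) → Set
IsDegenerateOrdering G κ vs =
  ∀ (i : Fin (length vs)) →
    degIn G (take (suc (toℕ i)) vs) (lookup vs i) Data.Nat.≤ κ (lookup vs i)

IsDegenerateMinus : ∀ {n} → Graph n → (Fin n → ℕ) → Subset n → Set
IsDegenerateMinus {n} G κ M =
  Σ (List (Fin n)) λ vs →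
    Unique vs × (∀ v → (v ∈ₗ vs) ⇔ (v ∉ M)) × IsDegenerateOrdering G κ vs

-- Activation stages and degenerate orderings are reverses of each other.  If v
-- is activated in round i + 1, then since τ(v) + κ(v) = deg v, the requirement
-- "at least τ(v) neighbours are active after round i" says exactly "at most
-- κ(v) neighbours are activated no earlier than v".  Hence listing V(G) ∖ M by
-- decreasing stage is a κ-degenerate ordering, and conversely the j-th vertex
-- of a κ-degenerate ordering of length h can be activated in round h − j.
module Submission where

open import Defs
open import Data.Nat using (ℕ)
open import Data.Integer using (ℤ; +_; _+_)
open import Data.Fin using (Fin)
open import Data.Fin.Subset using (Subset)
open import Function.Bundles using (_⇔_)
open import Relation.Binary.PropositionalEquality using (_≡_)

open import Data.Bool using (Bool; true; false; _∧_; not; T; if_then_else_)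
open import Data.Bool.Properties using (∧-assoc; ∧-identityʳ; ∧-zeroʳ; T-∧; T-≡)
open import Data.Empty using (⊥-elim)
open import Data.Fin using (zero; suc; toℕ)
open import Data.Fin.Properties using (_≟_)
open import Data.Fin.Subset using (_∈_; _∉_)
open import Data.Fin.Subset.Properties using (_∈?_)
open import Data.Integer using (-[1+_]; -≤+; +≤+) renaming (_≤_ to _≤ℤ_)
open import Data.Integer.Properties using (+-monoˡ-≤; drop‿+≤+; +-injective)
open import Data.List using (List; []; _∷_; length; lookup; take; filter; allFin)
open import Data.List.Membership.Propositional using () renaming (_∈_ to _∈ₗ_; _∉_ to _∉ₗ_)
open import Data.List.Membership.Propositional.Properties using (∈-filter⁺; ∈-filter⁻; ∈-allFin; ∈-lookup)
open import Data.List.Relation.Binary.Permutation.Propositional using (↭-sym; ↭⇒↭ₛ)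
open import Data.List.Relation.Binary.Permutation.Propositional.Properties using (∈-resp-↭)
import Data.List.Relation.Binary.Permutation.Setoid.Properties as PermutationSetoid
open import Data.List.Relation.Unary.All as All using (All; []; _∷_)
open import Data.List.Relation.Unary.AllPairs using (AllPairs; []; _∷_)
open import Data.List.Relation.Unary.Any using (here; there; index)
open import Data.List.Relation.Unary.Any.Properties using (lookup-index)
import Data.List.Relation.Unary.Sorted.TotalOrder.Properties as Sorted
open import Data.List.Relation.Unary.Unique.Propositional using (Unique)
open import Data.List.Relation.Unary.Unique.Propositional.Properties using (filter⁺; take⁺; allFin⁺)
import Data.List.Sort as Sort
open import Data.Nat using (zero; suc; _≤_; _≤ᵇ_; z≤n; s≤s) renaming (_+_ to _+ℕ_)
open import Data.Nat.Properties
  using (≤-refl; ≤-trans; ≤-reflexive; m≤n+m; +-monoʳ-≤; +-mono-≤; +-suc; +-identityʳ;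
         +-cancelˡ-≤; +-cancelʳ-≤; n≤1+n; <⇒≱; ≰⇒>; _≤?_; ≤-decTotalOrder; n≮n; module ≤-Reasoning)
open import Data.Product using (_,_; proj₂; _×_)
open import Function.Bundles using (mk⇔; module Equivalence)
open Equivalence using (to; from)
open import Function.Base using (_∘_; case_of_)
open import Relation.Binary.Core using (Rel)
open import Relation.Binary.Bundles using (DecTotalOrder)
open import Relation.Binary.Definitions using (Reflexive; DecidableEquality)
import Relation.Binary.Construct.Flip.EqAndOrd as Flip
import Relation.Binary.Construct.On as On
open import Relation.Binary.PropositionalEquality using (_≢_; refl; trans; cong; cong₂; subst; setoid; module ≡-Reasoning) renaming (sym to ≡-sym)
open import Relation.Nullary using (Dec; ¬_; yes; no; does)
open import Relation.Nullary.Decidable using (¬?; decidable-stable)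

i+k≡a+b⇒i≤a⇔b≤k : ∀ (i : ℤ) (k a b : ℕ) → i + + k ≡ + (a +ℕ b) → (i ≤ℤ + a) ⇔ (b ≤ k)
i+k≡a+b⇒i≤a⇔b≤k i k a b i+k≡a+b = mk⇔ i≤a⇒b≤k (b≤k⇒i≤a i i+k≡a+b)
  where
  i≤a⇒b≤k : i ≤ℤ + a → b ≤ k
  i≤a⇒b≤k i≤a = +-cancelˡ-≤ a b k (drop‿+≤+ (subst (_≤ℤ + (a +ℕ k)) i+k≡a+b (+-monoˡ-≤ (+ k) i≤a)))
  b≤k⇒i≤a : ∀ i → i + + k ≡ + (a +ℕ b) → b ≤ k → i ≤ℤ + a
  b≤k⇒i≤a -[1+ _ ] _ _ = -≤+
  b≤k⇒i≤a (+ j) j+k≡a+b b≤k = +≤+ (+-cancelʳ-≤ k j a (≤-trans (≤-reflexive (+-injective j+k≡a+b)) (+-monoʳ-≤ a b≤k)))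

T-not-does⇔¬ : ∀ {a} {A : Set a} (a? : Dec A) → T (not (does a?)) ⇔ (¬ A)
T-not-does⇔¬ (yes a) = mk⇔ (λ ()) (λ ¬a → ¬a a)
T-not-does⇔¬ (no ¬a) = mk⇔ (λ _ → ¬a) _

countFin-cong : ∀ {n} (f g : Fin n → Bool) → (∀ u → f u ≡ g u) → countFin f ≡ countFin g
countFin-cong {zero}  f g f≗g = refl
countFin-cong {suc n} f g f≗g =
  cong₂ _+ℕ_ (cong (λ b → if b then 1 else 0) (f≗g zero))
             (countFin-cong (λ u → f (suc u)) (λ u → g (suc u)) (λ u → f≗g (suc u)))

countFin-mono : ∀ {n} (f g : Fin n → Bool) → (∀ u → T (f u) → T (g u)) → countFin f ≤ countFin g
countFin-mono {zero}  f g f⇒g = z≤n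
countFin-mono {suc n} f g f⇒g with f zero | g zero | f⇒g zero
... | false | _     | _ = ≤-trans (countFin-mono (f ∘ suc) (g ∘ suc) (f⇒g ∘ suc)) (m≤n+m _ _)
... | true  | true  | _ = s≤s (countFin-mono (f ∘ suc) (g ∘ suc) (f⇒g ∘ suc))
... | true  | false | f⇒g₀ = ⊥-elim (f⇒g₀ _)

countFin-false : ∀ {n} → countFin {n} (λ _ → false) ≡ 0
countFin-false {zero}  = refl
countFin-false {suc n} = countFin-false {n}

countFin-∧-split : ∀ {n} (p q : Fin n → Bool) →
  countFin (λ u → p u ∧ q u) +ℕ countFin (λ u → p u ∧ not (q u)) ≡ countFin p
countFin-∧-split {zero}  p q = refl
countFin-∧-split {suc n} p q with p zero | q zero | countFin-∧-split (λ u → p (suc u)) (λ u → q (suc u))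
... | false | _     | split = split
... | true  | true  | split = cong suc split
... | true  | false | split = trans (+-suc _ _) (cong suc split)

countFin-∧-≟ : ∀ {n} (f : Fin n → Bool) (x : Fin n) →
  countFin (λ u → f u ∧ does (u ≟ x)) ≡ (if f x then 1 else 0)
countFin-∧-≟ {suc n} f zero = begin
  (if f zero ∧ true then 1 else 0) +ℕ countFin (λ u → f (suc u) ∧ false)
    ≡⟨ cong₂ _+ℕ_ (cong (λ b → if b then 1 else 0) (∧-identityʳ (f zero)))
                  (trans (countFin-cong _ _ (λ u → ∧-zeroʳ (f (suc u)))) (countFin-false {n})) ⟩
  (if f zero then 1 else 0) +ℕ 0
    ≡⟨ +-identityʳ _ ⟩
  (if f zero then 1 else 0) ∎
  where open ≡-Reasoning
countFin-∧-≟ {suc n} f (suc x) =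
  trans (cong (λ b → (if b then 1 else 0) +ℕ countFin (λ u → f (suc u) ∧ does (u ≟ x))) (∧-zeroʳ (f zero)))
        (countFin-∧-≟ (λ u → f (suc u)) x)

module _ {n : ℕ} (p : Fin n → Bool) where

  countList≤countFin : (q : Fin n → Bool) (S : List (Fin n)) → Unique S → All (λ u → T (q u)) S →
    countList p S ≤ countFin (λ u → p u ∧ q u)
  countList≤countFin q [] _ _ = z≤n
  countList≤countFin q (x ∷ xs) (x∉xs ∷ xs-unique) (qx ∷ q-xs) = begin
    (if p x then 1 else 0) +ℕ countList p xs
      ≤⟨ +-monoʳ-≤ _ (countList≤countFin q∖x xs xs-unique (All.zipWith q∖x-holds (q-xs , x∉xs))) ⟩
    (if p x then 1 else 0) +ℕ countFin (λ u → p u ∧ q∖x u)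
      ≡⟨ cong₂ _+ℕ_ (≡-sym at-x) (countFin-cong _ _ (λ u → ≡-sym (∧-assoc (p u) (q u) _))) ⟩
    countFin (λ u → (p u ∧ q u) ∧ does (u ≟ x)) +ℕ countFin (λ u → (p u ∧ q u) ∧ not (does (u ≟ x)))
      ≡⟨ countFin-∧-split (λ u → p u ∧ q u) (λ u → does (u ≟ x)) ⟩
    countFin (λ u → p u ∧ q u) ∎
    where
    open ≤-Reasoning
    q∖x : Fin n → Bool
    q∖x u = q u ∧ not (does (u ≟ x))
    q∖x-holds : ∀ {u} → T (q u) × x ≢ u → T (q∖x u)
    q∖x-holds {u} (qu , x≢u) =
      from T-∧ (qu , from (T-not-does⇔¬ (u ≟ x)) (λ u≡x → x≢u (≡-sym u≡x)))
    at-x : countFin (λ u → (p u ∧ q u) ∧ does (u ≟ x)) ≡ (if p x then 1 else 0)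
    at-x = trans (countFin-∧-≟ (λ u → p u ∧ q u) x)
                 (cong (λ b → if b then 1 else 0) (trans (cong (p x ∧_) (to T-≡ qx)) (∧-identityʳ (p x))))

  countFin≤countList : (q : Fin n → Bool) (S : List (Fin n)) → (∀ u → T (q u) → u ∈ₗ S) →
    countFin (λ u → p u ∧ q u) ≤ countList p S
  countFin≤countList q [] q⊆[] = begin
    countFin (λ u → p u ∧ q u) ≤⟨ countFin-mono _ (λ _ → false) (λ u pq → case q⊆[] u (proj₂ (to T-∧ pq)) of λ ()) ⟩
    countFin {n} (λ _ → false) ≡⟨ countFin-false {n} ⟩
    0                          ∎
    where open ≤-Reasoning
  countFin≤countList q (x ∷ xs) q⊆x∷xs = begin
    countFin (λ u → p u ∧ q u)
      ≡⟨ ≡-sym (countFin-∧-split (λ u → p u ∧ q u) (λ u → does (u ≟ x))) ⟩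
    countFin (λ u → (p u ∧ q u) ∧ does (u ≟ x)) +ℕ countFin (λ u → (p u ∧ q u) ∧ not (does (u ≟ x)))
      ≤⟨ +-mono-≤ at-x≤ (≤-reflexive (countFin-cong _ _ (λ u → ∧-assoc (p u) (q u) _))) ⟩
    (if p x then 1 else 0) +ℕ countFin (λ u → p u ∧ q∖x u)
      ≤⟨ +-monoʳ-≤ _ (countFin≤countList q∖x xs q∖x⊆xs) ⟩
    (if p x then 1 else 0) +ℕ countList p xs ∎
    where
    open ≤-Reasoning
    q∖x : Fin n → Bool
    q∖x u = q u ∧ not (does (u ≟ x))
    q∖x⊆xs : ∀ u → T (q∖x u) → u ∈ₗ xs
    q∖x⊆xs u q∖xu with to T-∧ q∖xu
    ... | qu , u≢x with q⊆x∷xs u qu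
    ...   | here u≡x = ⊥-elim (to (T-not-does⇔¬ (u ≟ x)) u≢x u≡x)
    ...   | there u∈xs = u∈xs
    at-x≤ : countFin (λ u → (p u ∧ q u) ∧ does (u ≟ x)) ≤ (if p x then 1 else 0)
    at-x≤ = begin
      countFin (λ u → (p u ∧ q u) ∧ does (u ≟ x)) ≤⟨ countFin-mono _ _ (λ u → drop-middle (p u) (q u) _) ⟩
      countFin (λ u → p u ∧ does (u ≟ x))         ≡⟨ countFin-∧-≟ p x ⟩
      (if p x then 1 else 0)                       ∎
      where
      drop-middle : ∀ a b c → T ((a ∧ b) ∧ c) → T (a ∧ c)
      drop-middle true true c abc = abc

AllPairs⇒All-take-lookup : ∀ {a r} {A : Set a} {R : Rel A r} → Reflexive R →
  ∀ {xs} → AllPairs R xs → (j : Fin (length xs)) → All (λ u → R u (lookup xs j)) (take (suc (toℕ j)) xs)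
AllPairs⇒All-take-lookup R-refl {x ∷ xs} (x-R ∷ xs-R) zero    = R-refl ∷ []
AllPairs⇒All-take-lookup R-refl {x ∷ xs} (x-R ∷ xs-R) (suc j) =
  All.lookup x-R (∈-lookup j) ∷ AllPairs⇒All-take-lookup R-refl xs-R j

module _ {a} {A : Set a} (_≟ₐ_ : DecidableEquality A) where

  -- rank xs u = length xs − (position of u in xs), and 0 when u ∉ xs.
  rank : List A → A → ℕ
  rank []       u = 0
  rank (x ∷ xs) u with u ≟ₐ x
  ... | yes _ = suc (length xs)
  ... | no  _ = rank xs u

  rank≤length : ∀ xs u → rank xs u ≤ length xs
  rank≤length []       u = z≤n
  rank≤length (x ∷ xs) u with u ≟ₐ x
  ... | yes _ = ≤-refl
  ... | no  _ = ≤-trans (rank≤length xs u) (n≤1+n (length xs))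

  rank≡0⇔∉ : ∀ xs u → rank xs u ≡ 0 ⇔ u ∉ₗ xs
  rank≡0⇔∉ []       u = mk⇔ (λ _ ()) (λ _ → refl)
  rank≡0⇔∉ (x ∷ xs) u with u ≟ₐ x
  ... | yes u≡x = mk⇔ (λ ()) (λ u∉x∷xs → ⊥-elim (u∉x∷xs (here u≡x)))
  ... | no  u≢x = mk⇔
    (λ r≡0 → λ { (here u≡x) → u≢x u≡x ; (there u∈xs) → to (rank≡0⇔∉ xs u) r≡0 u∈xs })
    (λ u∉x∷xs → from (rank≡0⇔∉ xs u) (λ u∈xs → u∉x∷xs (there u∈xs)))

  rank≡suc⇒∈ : ∀ xs u {i} → rank xs u ≡ suc i → u ∈ₗ xs
  rank≡suc⇒∈ (x ∷ xs) u r≡ with u ≟ₐ x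
  ... | yes u≡x = here u≡x
  ... | no  _   = there (rank≡suc⇒∈ xs u r≡)

  rank-lookup≤⇒∈-take : ∀ {xs} → Unique xs → (j : Fin (length xs)) (u : A) →
    rank xs (lookup xs j) ≤ rank xs u → u ∈ₗ take (suc (toℕ j)) xs
  rank-lookup≤⇒∈-take {x ∷ xs} _ zero u r≤ with x ≟ₐ x | u ≟ₐ x
  ... | no x≢x | _       = ⊥-elim (x≢x refl)
  ... | yes _  | yes u≡x = here u≡x
  ... | yes _  | no  _   = ⊥-elim (n≮n _ (≤-trans r≤ (rank≤length xs u)))
  rank-lookup≤⇒∈-take {x ∷ xs} (x∉xs ∷ xs-unique) (suc j) u r≤ with lookup xs j ≟ₐ x | u ≟ₐ x
  ... | yes w≡x | _       = ⊥-elim (All.lookup x∉xs (∈-lookup j) (≡-sym w≡x))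
  ... | no  _   | yes u≡x = here u≡x
  ... | no  _   | no  _   = there (rank-lookup≤⇒∈-take xs-unique j u r≤)

countNeighbours : ∀ {n} → Graph n → Fin n → (Fin n → Bool) → ℕ
countNeighbours G v q = countFin (λ u → adj G v u ∧ q u)

module _ {n} (G : Graph n) (κ : Fin n → ℕ) (τ : Fin n → ℤ)
         (τ+κ≡deg : ∀ v → τ v + + κ v ≡ + deg G v) where

  τ≤countNeighbours⇔countNeighbours-not≤κ : ∀ v (q : Fin n → Bool) →
    (τ v ≤ℤ + countNeighbours G v q) ⇔ (countNeighbours G v (λ u → not (q u)) ≤ κ v)
  τ≤countNeighbours⇔countNeighbours-not≤κ v q =
    i+k≡a+b⇒i≤a⇔b≤k (τ v) (κ v) _ _ (trans (τ+κ≡deg v) (cong +_ (≡-sym (countFin-∧-split (adj G v) q))))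

  dynamicMonopoly⇒degenerate : ∀ M → IsDynamicMonopoly G τ M → IsDegenerateMinus G κ M
  dynamicMonopoly⇒degenerate M (st , M⇔st≡0 , st-threshold) = vs , vs-unique , vs-members , vs-degenerate
    where
    byDecreasingStage : DecTotalOrder _ _ _
    byDecreasingStage = On.decTotalOrder (Flip.decTotalOrder ≤-decTotalOrder) st
    open Sort byDecreasingStage using (sort; sort-↭; sort-↗)

    _∉?M : ∀ v → Dec (v ∉ M)
    v ∉?M = ¬? (v ∈? M)

    outside : List (Fin n)
    outside = filter _∉?M (allFin n)

    vs : List (Fin n)
    vs = sort outside

    vs-unique : Unique vs
    vs-unique = PermutationSetoid.Unique-resp-↭ (setoid (Fin n)) (↭⇒↭ₛ (↭-sym (sort-↭ outside)))
                                                (filter⁺ _∉?M (allFin⁺ n))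

    vs-members : ∀ v → (v ∈ₗ vs) ⇔ (v ∉ M)
    vs-members v = mk⇔ (λ v∈vs → proj₂ (∈-filter⁻ _∉?M {xs = allFin n} (∈-resp-↭ (sort-↭ outside) v∈vs)))
                       (λ v∉M → ∈-resp-↭ (↭-sym (sort-↭ outside)) (∈-filter⁺ _∉?M (∈-allFin v) v∉M))

    vs-decreasing : AllPairs (λ u w → st w ≤ st u) vs
    vs-decreasing = Sorted.Sorted⇒AllPairs (DecTotalOrder.totalOrder byDecreasingStage) (sort-↗ outside)

    degIn-later≤κ : ∀ v s → st v ≡ suc s → (S : List (Fin n)) → Unique S → All (λ u → st v ≤ st u) S →
      degIn G S v ≤ κ v
    degIn-later≤κ v s st≡ S S-unique S-later = ≤-trans
      (countList≤countFin (adj G v) _ S S-unique (All.map later S-later))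
      (to (τ≤countNeighbours⇔countNeighbours-not≤κ v _) (st-threshold v s st≡))
      where
      later : ∀ {u} → st v ≤ st u → T (not (st u ≤ᵇ s))
      later {u} v≤u = from (T-not-does⇔¬ (st u ≤? s)) (<⇒≱ (subst (_≤ st u) st≡ v≤u))

    vs-degenerate : IsDegenerateOrdering G κ vs
    vs-degenerate j with st (lookup vs j) in st≡
    ... | zero  = ⊥-elim (to (vs-members _) (∈-lookup j) (from (M⇔st≡0 _) st≡))
    ... | suc s = degIn-later≤κ (lookup vs j) s st≡ (take (suc (toℕ j)) vs) (take⁺ _ vs-unique)
                    (AllPairs⇒All-take-lookup ≤-refl vs-decreasing j)

  degenerate⇒dynamicMonopoly : ∀ M → IsDegenerateMinus G κ M → IsDynamicMonopoly G τ M
  degenerate⇒dynamicMonopoly M (vs , vs-unique , vs-members , vs-degenerate) = st , M⇔st≡0 , st-threshold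
    where
    st : Fin n → ℕ
    st = rank _≟_ vs

    M⇔st≡0 : ∀ v → (v ∈ M) ⇔ (st v ≡ 0)
    M⇔st≡0 v = mk⇔
      (λ v∈M → from (rank≡0⇔∉ _≟_ vs v) (λ v∈vs → to (vs-members v) v∈vs v∈M))
      (λ st≡0 → decidable-stable (v ∈? M)
                   (λ v∉M → to (rank≡0⇔∉ _≟_ vs v) st≡0 (from (vs-members v) v∉M)))

    st-threshold : ∀ v i → st v ≡ suc i → τ v ≤ℤ + countNeighbours G v (λ u → st u ≤ᵇ i)
    st-threshold v i st≡ = from (τ≤countNeighbours⇔countNeighbours-not≤κ v _)
      (≤-trans (countFin≤countList (adj G v) _ prefix covered) bound)
      where
      v∈vs : v ∈ₗ vs
      v∈vs = rank≡suc⇒∈ _≟_ vs v st≡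
      j : Fin (length vs)
      j = index v∈vs
      prefix : List (Fin n)
      prefix = take (suc (toℕ j)) vs
      bound : degIn G prefix v ≤ κ v
      bound = subst (λ w → degIn G prefix w ≤ κ w) (≡-sym (lookup-index v∈vs)) (vs-degenerate j)
      covered : ∀ u → T (not (st u ≤ᵇ i)) → u ∈ₗ prefix
      covered u later = rank-lookup≤⇒∈-take _≟_ vs-unique j u (begin
        st (lookup vs j) ≡⟨ cong st (≡-sym (lookup-index v∈vs)) ⟩
        st v             ≡⟨ st≡ ⟩
        suc i            ≤⟨ ≰⇒> (to (T-not-does⇔¬ (st u ≤? i)) later) ⟩
        st u             ∎)
        where open ≤-Reasoning

theorem2 : ∀ {n} (G : Graph n) (κ : Fin n → ℕ) (τ : Fin n → ℤ) →
    (∀ v → τ v + + κ v ≡ + deg G v) →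
    ∀ (M : Subset n) → IsDynamicMonopoly G τ M ⇔ IsDegenerateMinus G κ M
theorem2 G κ τ τ+κ≡deg M =
  mk⇔ (dynamicMonopoly⇒degenerate G κ τ τ+κ≡deg M) (degenerate⇒dynamicMonopoly G κ τ τ+κ≡deg M)
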